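{- Let $\mathcal{Q}=(Q,\bigsqcup,\odot,{}^{*},e)$ be a Foulis quantale with associated operation ${}^{\perp}$. Then: (1) $0^{\perp}=e=e^{\perp\perp}$ and $e^{\perp}=0=0^{\perp\perp}$; (2) $(x\odot y^{\perp\perp})^{\perp}=(x\odot y)^{\perp}$ for all $x,y\in Q$; (3) $\bigl(\bigsqcup_{i\in I}x_i^{\perp\perp}\bigr)^{\perp}=\bigl(\bigsqcup_{i\in I}x_i\bigr)^{\perp}$ for every indexed family $\{x_i\}_{i\in I}\subseteq Q$; (4) $(x^{\perp\perp}\odot y)^{\perp\perp}=\bigl(x^{\perp}\sqcup(x^{\perp}\sqcup y)^{\perp}\bigr)^{\perp}$ for all $x,y\in Q$.
   Context: A unital involutive quantale is $(Q,\bigsqcup,\odot,{}^*,e)$ where $(Q,\bigsqcup)$ is a complete join-semilattice (hence a complete lattice with order $\sqsubseteq$, binary join $\sqcup$, least element $0=\bigsqcup\emptyset$, greatest element $1=\bigsqcup Q$), $\odot$ is associative and distributes over arbitrary joins in each argument, $e$ is a two-sided unit for $\odot$, and ${}^*$ satisfies $x^{**}=x$, $(x\odot y)^*=y^*\odot x^*$ and $(\bigsqcup_i x_i)^*=\bigsqcup_i x_i^*$ for arbitrary (possibly empty) families. A Foulis quantale is a unital involutive quantale together with a map $[-]:Q\to Q$ such that for all $s,x\in Q$: $[s]\odot[s]=[s]=[s]^*$; $[e]=0$; and $s\odot x=0$ iff there exists $y\in Q$ with $x=[s]\odot y$. One writes $t^{\perp}:=[t^{*}]$ for $t\in Q$.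 -}

module Defs where

open import Level using (Level; Lift; lift; _⊔_) renaming (suc to lsuc)
open import Data.Empty using (⊥)
open import Data.Bool using (Bool; true; false)
open import Data.Product using (∃)
open import Relation.Binary.PropositionalEquality using (_≡_)
open import Relation.Binary.Structures using (IsPartialOrder)
open import Function.Bundles using (_⇔_)

record FoulisQuantale (c ℓ ι : Level) : Set (lsuc (c ⊔ ℓ ⊔ ι)) where
  infixl 7 _⊙_
  field
    Q       : Set c
    _⊑_     : Q → Q → Set ℓ
    ⊑-isPartialOrder : IsPartialOrder _≡_ _⊑_
    ⨆       : {I : Set ι} → (I → Q) → Q
    ⨆-upper : {I : Set ι} (f : I → Q) (i : I) → f i ⊑ ⨆ f
    ⨆-least : {I : Set ι} (f : I → Q) (u : Q) → (∀ i → f i ⊑ u) → ⨆ f ⊑ u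
    _⊙_     : Q → Q → Q
    e       : Q
    _*      : Q → Q
    ⊙-assoc : ∀ x y z → (x ⊙ y) ⊙ z ≡ x ⊙ (y ⊙ z)
    ⊙-distribˡ-⨆ : ∀ x {I : Set ι} (f : I → Q) → x ⊙ ⨆ f ≡ ⨆ (λ i → x ⊙ f i)
    ⊙-distribʳ-⨆ : ∀ x {I : Set ι} (f : I → Q) → ⨆ f ⊙ x ≡ ⨆ (λ i → f i ⊙ x)
    ⊙-identityˡ : ∀ x → e ⊙ x ≡ x
    ⊙-identityʳ : ∀ x → x ⊙ e ≡ x
    *-involutive : ∀ x → (x *) * ≡ x
    *-antihom    : ∀ x y → (x ⊙ y) * ≡ (y *) ⊙ (x *)
    *-⨆          : {I : Set ι} (f : I → Q) → (⨆ f) * ≡ ⨆ (λ i → f i *)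
    [_]     : Q → Q

  𝟘 : Q
  𝟘 = ⨆ {I = Lift ι ⊥} (λ ())

  _⊔Q_ : Q → Q → Q
  x ⊔Q y = ⨆ {I = Lift ι Bool} (λ { (lift true) → x ; (lift false) → y })

  field
    [-]-idem    : ∀ s → [ s ] ⊙ [ s ] ≡ [ s ]
    [-]-selfadj : ∀ s → [ s ] * ≡ [ s ]
    [e]≡0       : [ e ] ≡ 𝟘
    foulis      : ∀ s x → (s ⊙ x ≡ 𝟘) ⇔ ∃ (λ y → x ≡ [ s ] ⊙ y)

  _⊥ : Q → Q
  t ⊥ = [ t * ]

-- By the Foulis axiom, [ s ] generates the right annihilator of s, so
-- [ a ] ≡ [ b ] as soon as a and b have the same right annihilators.  All four
-- identities are instances: s and [ [ s ] ] have the same right annihilators,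
-- the right annihilator of a join is the intersection of the right
-- annihilators, and in (4), writing q = x ⊥, p = q ⊥ and w = (q ⊔ y) ⊥, the
-- right annihilator of v = (p ⊙ y) ⊥ is that of q * intersected with that of w:
-- one inclusion because (p ⊙ y) * annihilates q and w, the other because
-- v ⊙ p = v ⊙ p ⊙ w and every x with q * ⊙ x = 0 satisfies x = p ⊙ x.
module Submission where

open import Defs
open import Level using (Level; lift)
open import Data.Bool using (true; false)
open import Data.Product using (_×_; _,_; proj₁; proj₂)
open import Relation.Binary.PropositionalEquality
  using (_≡_; sym; trans; cong; cong₂; subst; subst₂; module ≡-Reasoning)
open import Relation.Binary.Structures using (IsPartialOrder)
open import Function.Bundles using (_⇔_; mk⇔; Equivalence)
open import Function.Properties.Equivalence using () renaming (sym to ⇔-sym)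

module FoulisQuantaleProperties {c ℓ ι : Level} (F : FoulisQuantale c ℓ ι) where
  open FoulisQuantale F
  open IsPartialOrder ⊑-isPartialOrder using (antisym; reflexive)
  open Equivalence using (to; from)
  open ≡-Reasoning

  𝟘-least : ∀ x → 𝟘 ⊑ x
  𝟘-least x = ⨆-least _ x (λ ())

  ⨆≡𝟘⇔ : {I : Set ι} {f : I → Q} → ⨆ f ≡ 𝟘 ⇔ (∀ i → f i ≡ 𝟘)
  ⨆≡𝟘⇔ {f = f} = mk⇔
    (λ h i → antisym (subst (f i ⊑_) h (⨆-upper f i)) (𝟘-least (f i)))
    (λ h → antisym (⨆-least f 𝟘 (λ i → reflexive (h i))) (𝟘-least (⨆ f)))

  ⊙-zeroʳ : ∀ x → x ⊙ 𝟘 ≡ 𝟘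
  ⊙-zeroʳ x = trans (⊙-distribˡ-⨆ x _) (from ⨆≡𝟘⇔ (λ ()))

  ⊙-zeroˡ : ∀ x → 𝟘 ⊙ x ≡ 𝟘
  ⊙-zeroˡ x = trans (⊙-distribʳ-⨆ x _) (from ⨆≡𝟘⇔ (λ ()))

  *-zero : 𝟘 * ≡ 𝟘
  *-zero = trans (*-⨆ _) (from ⨆≡𝟘⇔ (λ ()))

  *-identity : e * ≡ e
  *-identity = begin
    e *               ≡⟨ sym (⊙-identityʳ (e *)) ⟩
    e * ⊙ e           ≡⟨ cong (e * ⊙_) (sym (*-involutive e)) ⟩
    e * ⊙ (e *) *     ≡⟨ sym (*-antihom (e *) e) ⟩
    (e * ⊙ e) *       ≡⟨ cong _* (⊙-identityʳ (e *)) ⟩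
    (e *) *           ≡⟨ *-involutive e ⟩
    e                 ∎

  ⨆-⊙≡𝟘⇔ : {I : Set ι} {f : I → Q} {x : Q} → ⨆ f ⊙ x ≡ 𝟘 ⇔ (∀ i → f i ⊙ x ≡ 𝟘)
  ⨆-⊙≡𝟘⇔ {f = f} {x} = subst (λ z → z ≡ 𝟘 ⇔ (∀ i → f i ⊙ x ≡ 𝟘)) (sym (⊙-distribʳ-⨆ x f)) ⨆≡𝟘⇔

  *-⨆-⊙≡𝟘⇔ : {I : Set ι} {f : I → Q} {x : Q} → (⨆ f) * ⊙ x ≡ 𝟘 ⇔ (∀ i → f i * ⊙ x ≡ 𝟘)
  *-⨆-⊙≡𝟘⇔ {f = f} {x} = subst (λ z → z ⊙ x ≡ 𝟘 ⇔ (∀ i → f i * ⊙ x ≡ 𝟘)) (sym (*-⨆ f)) ⨆-⊙≡𝟘⇔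

  *-⊔-⊙≡𝟘⇔ : ∀ {u w x} → (u ⊔Q w) * ⊙ x ≡ 𝟘 ⇔ (u * ⊙ x ≡ 𝟘 × w * ⊙ x ≡ 𝟘)
  *-⊔-⊙≡𝟘⇔ = mk⇔
    (λ h → to *-⨆-⊙≡𝟘⇔ h (lift true) , to *-⨆-⊙≡𝟘⇔ h (lift false))
    (λ { (hu , hw) → from *-⨆-⊙≡𝟘⇔ λ { (lift true) → hu ; (lift false) → hw } })

  infix 4 _≈ₐ_
  _≈ₐ_ : Q → Q → Set c
  a ≈ₐ b = ∀ x → a ⊙ x ≡ 𝟘 ⇔ b ⊙ x ≡ 𝟘

  ≈ₐ-sym : ∀ {a b} → a ≈ₐ b → b ≈ₐ a
  ≈ₐ-sym h x = ⇔-sym (h x)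

  ≈ₐ-⊙ʳ : ∀ {a b} z → a ≈ₐ b → a ⊙ z ≈ₐ b ⊙ z
  ≈ₐ-⊙ʳ {a} {b} z h x =
    subst₂ _⇔_ (cong (_≡ 𝟘) (sym (⊙-assoc a z x))) (cong (_≡ 𝟘) (sym (⊙-assoc b z x))) (h (z ⊙ x))

  ≈ₐ-⨆ : {I : Set ι} {f g : I → Q} → (∀ i → f i ≈ₐ g i) → ⨆ f ≈ₐ ⨆ g
  ≈ₐ-⨆ h x = mk⇔
    (λ hf → from ⨆-⊙≡𝟘⇔ (λ i → to (h i x) (to ⨆-⊙≡𝟘⇔ hf i)))
    (λ hg → from ⨆-⊙≡𝟘⇔ (λ i → from (h i x) (to ⨆-⊙≡𝟘⇔ hg i)))

  []-absorbˡ : ∀ {s x} → s ⊙ x ≡ 𝟘 → x ≡ [ s ] ⊙ x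
  []-absorbˡ {s} {x} h with to (foulis s x) h
  ... | y , x≡[s]y = begin
    x                   ≡⟨ x≡[s]y ⟩
    [ s ] ⊙ y           ≡⟨ cong (_⊙ y) (sym ([-]-idem s)) ⟩
    [ s ] ⊙ [ s ] ⊙ y   ≡⟨ ⊙-assoc [ s ] [ s ] y ⟩
    [ s ] ⊙ ([ s ] ⊙ y) ≡⟨ cong ([ s ] ⊙_) (sym x≡[s]y) ⟩
    [ s ] ⊙ x           ∎

  ⊙-[]≡𝟘 : ∀ s → s ⊙ [ s ] ≡ 𝟘
  ⊙-[]≡𝟘 s = from (foulis s [ s ]) ([ s ] , sym ([-]-idem s))

  []-⊙-*≡𝟘 : ∀ s → [ s ] ⊙ s * ≡ 𝟘
  []-⊙-*≡𝟘 s = begin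
    [ s ] ⊙ s *     ≡⟨ cong (_⊙ s *) (sym ([-]-selfadj s)) ⟩
    [ s ] * ⊙ s *   ≡⟨ sym (*-antihom s [ s ]) ⟩
    (s ⊙ [ s ]) *   ≡⟨ cong _* (⊙-[]≡𝟘 s) ⟩
    𝟘 *             ≡⟨ *-zero ⟩
    𝟘               ∎

  *-absorbʳ : ∀ {s r} → s ⊙ r ≡ 𝟘 → r * ≡ r * ⊙ [ s ]
  *-absorbʳ {s} {r} h = begin
    r *               ≡⟨ cong _* ([]-absorbˡ h) ⟩
    ([ s ] ⊙ r) *     ≡⟨ *-antihom [ s ] r ⟩
    r * ⊙ [ s ] *     ≡⟨ cong (r * ⊙_) ([-]-selfadj s) ⟩
    r * ⊙ [ s ]       ∎

  []-⊙≡𝟘⇒*-⊙≡𝟘 : ∀ {s r x} → s ⊙ r ≡ 𝟘 → [ s ] ⊙ x ≡ 𝟘 → r * ⊙ x ≡ 𝟘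
  []-⊙≡𝟘⇒*-⊙≡𝟘 {s} {r} {x} sr≡𝟘 [s]x≡𝟘 = begin
    r * ⊙ x             ≡⟨ cong (_⊙ x) (*-absorbʳ sr≡𝟘) ⟩
    r * ⊙ [ s ] ⊙ x     ≡⟨ ⊙-assoc (r *) [ s ] x ⟩
    r * ⊙ ([ s ] ⊙ x)   ≡⟨ cong (r * ⊙_) [s]x≡𝟘 ⟩
    r * ⊙ 𝟘             ≡⟨ ⊙-zeroʳ (r *) ⟩
    𝟘                   ∎

  ≈ₐ-[[]] : ∀ s → s ≈ₐ [ [ s ] ]
  ≈ₐ-[[]] s x = mk⇔ to-[[]] from-[[]]
    where
    to-[[]] : s ⊙ x ≡ 𝟘 → [ [ s ] ] ⊙ x ≡ 𝟘
    to-[[]] h = begin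
      [ [ s ] ] ⊙ x             ≡⟨ cong ([ [ s ] ] ⊙_) ([]-absorbˡ h) ⟩
      [ [ s ] ] ⊙ ([ s ] ⊙ x)   ≡⟨ sym (⊙-assoc [ [ s ] ] [ s ] x) ⟩
      [ [ s ] ] ⊙ [ s ] ⊙ x     ≡⟨ cong (λ z → [ [ s ] ] ⊙ z ⊙ x) (sym ([-]-selfadj s)) ⟩
      [ [ s ] ] ⊙ [ s ] * ⊙ x   ≡⟨ cong (_⊙ x) ([]-⊙-*≡𝟘 [ s ]) ⟩
      𝟘 ⊙ x                     ≡⟨ ⊙-zeroˡ x ⟩
      𝟘                         ∎
    from-[[]] : [ [ s ] ] ⊙ x ≡ 𝟘 → s ⊙ x ≡ 𝟘
    from-[[]] h = subst (λ z → z ⊙ x ≡ 𝟘) (*-involutive s) ([]-⊙≡𝟘⇒*-⊙≡𝟘 ([]-⊙-*≡𝟘 s) h)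

  []-cong-≈ₐ : ∀ {a b} → a ≈ₐ b → [ a ] ≡ [ b ]
  []-cong-≈ₐ {a} {b} h = begin
    [ a ]               ≡⟨ []-absorbˡ (to (h [ a ]) (⊙-[]≡𝟘 a)) ⟩
    [ b ] ⊙ [ a ]       ≡⟨ cong₂ _⊙_ (sym ([-]-selfadj b)) (sym ([-]-selfadj a)) ⟩
    [ b ] * ⊙ [ a ] *   ≡⟨ sym (*-antihom [ a ] [ b ]) ⟩
    ([ a ] ⊙ [ b ]) *   ≡⟨ cong _* (sym ([]-absorbˡ (from (h [ b ]) (⊙-[]≡𝟘 b)))) ⟩
    [ b ] *             ≡⟨ [-]-selfadj b ⟩
    [ b ]               ∎

  ⊥-selfadjoint : ∀ t → (t ⊥) * ≡ t ⊥
  ⊥-selfadjoint t = [-]-selfadj (t *)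

  *-⊙-⊥≡𝟘 : ∀ t → t * ⊙ t ⊥ ≡ 𝟘
  *-⊙-⊥≡𝟘 t = ⊙-[]≡𝟘 (t *)

  ⊥-⊙≡𝟘 : ∀ t → t ⊥ ⊙ t ≡ 𝟘
  ⊥-⊙≡𝟘 t = subst (λ z → t ⊥ ⊙ z ≡ 𝟘) (*-involutive t) ([]-⊙-*≡𝟘 (t *))

  ⊥⊥-*-≈ₐ : ∀ t → (t ⊥ ⊥) * ≈ₐ t *
  ⊥⊥-*-≈ₐ t = subst (_≈ₐ t *) (sym t⊥⊥*≡[[t*]]) (≈ₐ-sym (≈ₐ-[[]] (t *)))
    where
    t⊥⊥*≡[[t*]] : (t ⊥ ⊥) * ≡ [ [ t * ] ]
    t⊥⊥*≡[[t*]] = trans (⊥-selfadjoint (t ⊥)) (cong [_] (⊥-selfadjoint t))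

  [𝟘]≡e : [ 𝟘 ] ≡ e
  [𝟘]≡e = sym (trans ([]-absorbˡ (⊙-zeroˡ e)) (⊙-identityʳ [ 𝟘 ]))

  𝟘⊥≡e : 𝟘 ⊥ ≡ e
  𝟘⊥≡e = trans (cong [_] *-zero) [𝟘]≡e

  e⊥≡𝟘 : e ⊥ ≡ 𝟘
  e⊥≡𝟘 = trans (cong [_] *-identity) [e]≡0

  e≡e⊥⊥ : e ≡ e ⊥ ⊥
  e≡e⊥⊥ = sym (trans (cong _⊥ e⊥≡𝟘) 𝟘⊥≡e)

  𝟘≡𝟘⊥⊥ : 𝟘 ≡ 𝟘 ⊥ ⊥
  𝟘≡𝟘⊥⊥ = sym (trans (cong _⊥ 𝟘⊥≡e) e⊥≡𝟘)

  ⊙-⊥⊥-⊥ : ∀ x y → (x ⊙ y ⊥ ⊥) ⊥ ≡ (x ⊙ y) ⊥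
  ⊙-⊥⊥-⊥ x y = []-cong-≈ₐ
    (subst₂ _≈ₐ_ (sym (*-antihom x (y ⊥ ⊥))) (sym (*-antihom x y)) (≈ₐ-⊙ʳ (x *) (⊥⊥-*-≈ₐ y)))

  ⨆-⊥⊥-⊥ : {I : Set ι} (x : I → Q) → (⨆ (λ i → x i ⊥ ⊥)) ⊥ ≡ (⨆ x) ⊥
  ⨆-⊥⊥-⊥ x = []-cong-≈ₐ
    (subst₂ _≈ₐ_ (sym (*-⨆ _)) (sym (*-⨆ x)) (≈ₐ-⨆ (λ i → ⊥⊥-*-≈ₐ (x i))))

  module ⊥-⊙-Annihilator (q y : Q) where
    private
      p t v w : Q
      p = q ⊥
      t = p ⊙ y
      v = t ⊥
      w = (q ⊔Q y) ⊥

      q*⊙w≡𝟘 : q * ⊙ w ≡ 𝟘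
      q*⊙w≡𝟘 = proj₁ (to *-⊔-⊙≡𝟘⇔ (*-⊙-⊥≡𝟘 (q ⊔Q y)))

      y*⊙w≡𝟘 : y * ⊙ w ≡ 𝟘
      y*⊙w≡𝟘 = proj₂ (to *-⊔-⊙≡𝟘⇔ (*-⊙-⊥≡𝟘 (q ⊔Q y)))

      t*-⊙ : ∀ r → t * ⊙ r ≡ y * ⊙ (p ⊙ r)
      t*-⊙ r = trans (cong (_⊙ r) (trans (*-antihom p y) (cong (y * ⊙_) (⊥-selfadjoint q))))
                     (⊙-assoc (y *) p r)

      t*⊙q≡𝟘 : t * ⊙ q ≡ 𝟘
      t*⊙q≡𝟘 = trans (t*-⊙ q) (trans (cong (y * ⊙_) (⊥-⊙≡𝟘 q)) (⊙-zeroʳ (y *)))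

      t*⊙w≡𝟘 : t * ⊙ w ≡ 𝟘
      t*⊙w≡𝟘 = trans (t*-⊙ w) (trans (cong (y * ⊙_) (sym ([]-absorbˡ q*⊙w≡𝟘))) y*⊙w≡𝟘)

      v⊙p≡v⊙p⊙w : v ⊙ p ≡ v ⊙ p ⊙ w
      v⊙p≡v⊙p⊙w = subst (λ z → z ≡ z ⊙ w) [p⊙v]*≡v⊙p (*-absorbʳ (from *-⊔-⊙≡𝟘⇔ (q*⊙p⊙v≡𝟘 , y*⊙p⊙v≡𝟘)))
        where
        [p⊙v]*≡v⊙p : (p ⊙ v) * ≡ v ⊙ p
        [p⊙v]*≡v⊙p = trans (*-antihom p v) (cong₂ _⊙_ (⊥-selfadjoint t) (⊥-selfadjoint q))
        q*⊙p⊙v≡𝟘 : q * ⊙ (p ⊙ v) ≡ 𝟘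
        q*⊙p⊙v≡𝟘 = trans (sym (⊙-assoc (q *) p v)) (trans (cong (_⊙ v) (*-⊙-⊥≡𝟘 q)) (⊙-zeroˡ v))
        y*⊙p⊙v≡𝟘 : y * ⊙ (p ⊙ v) ≡ 𝟘
        y*⊙p⊙v≡𝟘 = trans (sym (t*-⊙ v)) (*-⊙-⊥≡𝟘 t)

      annihilated-by-q*-and-w : ∀ {x} → q * ⊙ x ≡ 𝟘 → w ⊙ x ≡ 𝟘 → v ⊙ x ≡ 𝟘
      annihilated-by-q*-and-w {x} q*x≡𝟘 wx≡𝟘 = begin
        v ⊙ x               ≡⟨ cong (v ⊙_) ([]-absorbˡ q*x≡𝟘) ⟩
        v ⊙ (p ⊙ x)         ≡⟨ sym (⊙-assoc v p x) ⟩
        v ⊙ p ⊙ x           ≡⟨ cong (_⊙ x) v⊙p≡v⊙p⊙w ⟩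
        v ⊙ p ⊙ w ⊙ x       ≡⟨ ⊙-assoc (v ⊙ p) w x ⟩
        v ⊙ p ⊙ (w ⊙ x)     ≡⟨ cong (v ⊙ p ⊙_) wx≡𝟘 ⟩
        v ⊙ p ⊙ 𝟘           ≡⟨ ⊙-zeroʳ (v ⊙ p) ⟩
        𝟘                   ∎

      v≈ₐ[q⊔w]* : v ≈ₐ (q ⊔Q w) *
      v≈ₐ[q⊔w]* x = mk⇔
        (λ vx≡𝟘 → from *-⊔-⊙≡𝟘⇔ ([]-⊙≡𝟘⇒*-⊙≡𝟘 t*⊙q≡𝟘 vx≡𝟘 , []-⊙≡𝟘⇒*-⊙≡𝟘 t*⊙w≡𝟘 vx≡𝟘))
        (λ h → annihilated-by-q*-and-w (proj₁ (to *-⊔-⊙≡𝟘⇔ h))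
                 (subst (λ z → z ⊙ x ≡ 𝟘) (⊥-selfadjoint (q ⊔Q y)) (proj₂ (to *-⊔-⊙≡𝟘⇔ h))))

    ≈ₐ-⊔ : v * ≈ₐ (q ⊔Q w) *
    ≈ₐ-⊔ = subst (_≈ₐ (q ⊔Q w) *) (sym (⊥-selfadjoint t)) v≈ₐ[q⊔w]*

  ⊥-⊙-⊥⊥ : ∀ q y → (q ⊥ ⊙ y) ⊥ ⊥ ≡ (q ⊔Q ((q ⊔Q y) ⊥)) ⊥
  ⊥-⊙-⊥⊥ q y = []-cong-≈ₐ (⊥-⊙-Annihilator.≈ₐ-⊔ q y)

lemma2p21 : ∀ {c ℓ ι : Level} (F : FoulisQuantale c ℓ ι) → let open FoulisQuantale F in
    ((𝟘 ⊥ ≡ e) × (e ≡ (e ⊥) ⊥) × (e ⊥ ≡ 𝟘) × (𝟘 ≡ (𝟘 ⊥) ⊥))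
    × (∀ x y → (x ⊙ ((y ⊥) ⊥)) ⊥ ≡ (x ⊙ y) ⊥)
    × (∀ (I : Set ι) (x : I → Q) → (⨆ (λ i → (x i ⊥) ⊥)) ⊥ ≡ (⨆ x) ⊥)
    × (∀ x y → ((((x ⊥) ⊥) ⊙ y) ⊥) ⊥ ≡ ((x ⊥) ⊔Q (((x ⊥) ⊔Q y) ⊥)) ⊥)
lemma2p21 F =
  (𝟘⊥≡e , e≡e⊥⊥ , e⊥≡𝟘 , 𝟘≡𝟘⊥⊥) , ⊙-⊥⊥-⊥ , (λ _ → ⨆-⊥⊥-⊥) , (λ x → ⊥-⊙-⊥⊥ (x ⊥))
  where
  open FoulisQuantale F using (_⊥)
  open FoulisQuantaleProperties F
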